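{- Let $n\ge3$, $k\ge0$, let $T$ be a canonical reversible set in $G_n^k$, and let $(x,y),(x',y')\in T$. If $x\preceq y\prec x'\preceq y'$ and $x'<y$ in $S_n^k$, then $(x,y')\in T$.
   Context: The crown $S_n^k$ is the height-2 poset on $A\cup B$, $A=\{a_1,\dots,a_{n+k}\}$ minimal, $B=\{b_1,\dots,b_{n+k}\}$ maximal, indices cyclic mod $n+k$; $a_i$ is incomparable to $b_j$ iff $j\in\{i,\dots,i+k\}$ (mod $n+k$), otherwise $a_i<b_j$. $\mathrm{Inc}(A,B)$: incomparable pairs $(a,b)\in A\times B$; $G_n^k$ has vertex set $\mathrm{Inc}(A,B)$. Place points $u_1,\dots,u_{n+k}$ clockwise on a circle, with $a_i$ and $b_i$ both at $u_i$; $v_1\preceq v_2\preceq\cdots\preceq v_\ell$ means that traversing clockwise from the position of $v_1$ and stopping the first time the position of $v_\ell$ is reached, one visits the positions of $v_2,\dots,v_{\ell-1}$ in that order, with $\preceq$ allowing equal positions and $\prec$ requiring distinct positions. A subset of $A$ is contiguous if it is a block of cyclically consecutive elements; a sequence $\sigma=(x_1,\dots,x_r)$ of distinct elements of $A$ is $h$-contiguous if each $\{x_1,\dots,x_i\}$ is contiguous. $T(\sigma)$ contains all $(x_1,b)\in\mathrm{Inc}(A,B)$ and, for $1\le i<r$, $(x_{i+1},b)$ iff $(x_{i+1},b)\in\mathrm{Inc}(A,B)$ and $(x_i,b)\in T(\sigma)$. A canonical reversible set is $T(\sigma)$ for an $h$-contiguous $\sigma$ of length $k+1$. -}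

module Defs where

open import Data.Nat using (ℕ; zero; suc; _+_; _∸_; _≤_; _<_; _≤ᵇ_)
open import Data.Bool using (if_then_else_)
open import Data.Fin using (Fin; toℕ)
open import Data.List using (List; []; _∷_; length; take)
open import Data.List.Membership.Propositional using (_∈_)
open import Data.List.Relation.Unary.Unique.Propositional using (Unique)
open import Data.Product using (Σ; _×_; ∃)
open import Data.Sum using (_⊎_)
open import Data.Empty using (⊥)
open import Relation.Nullary using (¬_)
open import Relation.Binary.PropositionalEquality using (_≡_)
open import Function.Bundles using (_⇔_)

-- Crown S_n^k with N = n + k.  Elements a_i ∈ A and b_j ∈ B are both
-- represented by their index in Fin N (position u_i on the circle).

cw : (N : ℕ) → Fin N → Fin N → ℕ
cw N p q = if toℕ p ≤ᵇ toℕ q then toℕ q ∸ toℕ p else (N + toℕ q) ∸ toℕ p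

-- a_i ∥ b_j  iff  j ∈ {i, …, i+k} (mod N)
Inc : (n k : ℕ) → Fin (n + k) → Fin (n + k) → Set
Inc n k i j = cw (n + k) i j ≤ k

Below : (n k : ℕ) → Fin (n + k) → Fin (n + k) → Set
Below n k i j = ¬ Inc n k i j

-- x ⪯ y ≺ x' ⪯ y' : going clockwise from pos(x) and stopping the first
-- time pos(y') is reached, one visits pos(y) then pos(x'), with pos(y) ≠ pos(x').
ChainLeLtLe : (N : ℕ) → Fin N → Fin N → Fin N → Fin N → Set
ChainLeLtLe N x y x' y' = (cw N x y < cw N x x') × (cw N x x' ≤ cw N x y')

Contiguous : (N : ℕ) → List (Fin N) → Set
Contiguous N S = Σ (Fin N) λ s → Σ ℕ λ m → (m ≤ N) × (∀ a → (a ∈ S) ⇔ (cw N s a < m))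

HContiguous : (N : ℕ) → List (Fin N) → Set
HContiguous N σ = Unique σ × (∀ i → 1 ≤ i → i ≤ length σ → Contiguous N (take i σ))

-- T(σ).  T-aux P xs a b: membership of (a,b) among the pairs whose first
-- coordinate lies in xs, where P means "(previous element of σ, b) ∈ T(σ)".
T-aux : (n k : ℕ) → Set → List (Fin (n + k)) → Fin (n + k) → Fin (n + k) → Set
T-aux n k P [] a b = ⊥
T-aux n k P (x ∷ xs) a b = ((a ≡ x) × Inc n k x b × P) ⊎ T-aux n k (Inc n k x b × P) xs a b

T : (n k : ℕ) → List (Fin (n + k)) → Fin (n + k) → Fin (n + k) → Set
T n k [] a b = ⊥
T n k (x ∷ xs) a b = ((a ≡ x) × Inc n k x b) ⊎ T-aux n k (Inc n k x b) xs a b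

-- σ gives rise to a canonical reversible set T(σ)
CanonicalSeq : (n k : ℕ) → List (Fin (n + k)) → Set
CanonicalSeq n k σ = HContiguous (n + k) σ × (length σ ≡ suc k)

-- T(σ) consists of the pairs (x_i, b) with b incomparable to every one of
-- x_1, …, x_i.  If (x, y) and (x', y') lie in T(σ) and x' < y, then x' is not
-- among the elements of σ up to x, so it comes after x; hence y', being
-- incomparable to everything up to x', is incomparable to everything up to x.
module Submission where

open import Defs
open import Data.Nat using (ℕ; _≤_; _+_)
open import Data.Fin using (Fin)
open import Data.List using (List; []; _∷_)
open import Data.Product using (_×_; _,_)
open import Data.Sum using (_⊎_; inj₁; inj₂)
open import Data.Empty using (⊥; ⊥-elim)
open import Function.Bundles using (_⇔_; mk⇔; Equivalence)
open import Relation.Nullary using (¬_)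
open import Relation.Binary.PropositionalEquality using (_≡_; refl)

UpTo : {A B : Set} → (A → B → Set) → List A → A → B → Set
UpTo R []       a b = ⊥
UpTo R (x ∷ xs) a b = R x b × (a ≡ x ⊎ UpTo R xs a b)

UpTo-exchange : {A B : Set} (R : A → B → Set) (xs : List A) {x x' : A} {y y' : B} →
                UpTo R xs x y → UpTo R xs x' y' → ¬ R x' y → UpTo R xs x y'
UpTo-exchange R (z ∷ zs) (_ , inj₁ x≡z) (Rzy' , _) _ = Rzy' , inj₁ x≡z
UpTo-exchange R (z ∷ zs) (Rzy , inj₂ _) (_ , inj₁ refl) ¬Rx'y = ⊥-elim (¬Rx'y Rzy)
UpTo-exchange R (z ∷ zs) (_ , inj₂ u) (Rzy' , inj₂ u') ¬Rx'y =
  Rzy' , inj₂ (UpTo-exchange R zs u u' ¬Rx'y)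

module _ (n k : ℕ) where

  T-aux⇔UpTo : (P : Set) (xs : List (Fin (n + k))) {a b : Fin (n + k)} →
               T-aux n k P xs a b ⇔ (P × UpTo (Inc n k) xs a b)
  T-aux⇔UpTo P xs = mk⇔ (to P xs) (λ (p , u) → from P xs p u)
    where
    to : (P : Set) (xs : List (Fin (n + k))) {a b : Fin (n + k)} →
         T-aux n k P xs a b → P × UpTo (Inc n k) xs a b
    to P (x ∷ xs) (inj₁ (a≡x , i , p)) = p , i , inj₁ a≡x
    to P (x ∷ xs) (inj₂ t) with to _ xs t
    ... | (i , p) , u = p , i , inj₂ u

    from : (P : Set) (xs : List (Fin (n + k))) {a b : Fin (n + k)} →
           P → UpTo (Inc n k) xs a b → T-aux n k P xs a b
    from P (x ∷ xs) p (i , inj₁ a≡x) = inj₁ (a≡x , i , p)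
    from P (x ∷ xs) p (i , inj₂ u)   = inj₂ (from _ xs (i , p) u)

  T⇔UpTo : (σ : List (Fin (n + k))) {a b : Fin (n + k)} →
           T n k σ a b ⇔ UpTo (Inc n k) σ a b
  T⇔UpTo []       = mk⇔ (λ ()) (λ ())
  T⇔UpTo (x ∷ xs) = mk⇔ to from
    where
    to : ∀ {a b} → T n k (x ∷ xs) a b → UpTo (Inc n k) (x ∷ xs) a b
    to (inj₁ (a≡x , i)) = i , inj₁ a≡x
    to (inj₂ t) with Equivalence.to (T-aux⇔UpTo _ xs) t
    ... | i , u = i , inj₂ u

    from : ∀ {a b} → UpTo (Inc n k) (x ∷ xs) a b → T n k (x ∷ xs) a b
    from (i , inj₁ a≡x) = inj₁ (a≡x , i)
    from (i , inj₂ u)   = inj₂ (Equivalence.from (T-aux⇔UpTo _ xs) (i , u))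

proposition6p3 : (n k : ℕ) → 3 ≤ n → (σ : List (Fin (n + k))) → CanonicalSeq n k σ →
    (x y x' y' : Fin (n + k)) → T n k σ x y → T n k σ x' y' →
    ChainLeLtLe (n + k) x y x' y' → Below n k x' y → T n k σ x y'
proposition6p3 n k _ σ _ x y x' y' t t' _ x'<y =
  Equivalence.from (T⇔UpTo n k σ)
    (UpTo-exchange (Inc n k) σ (Equivalence.to (T⇔UpTo n k σ) t)
                               (Equivalence.to (T⇔UpTo n k σ) t') x'<y)
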